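{- Let $I=\{0,1\}\times\mathbb{N}$, let $\mathfrak{G}$ be the group of all permutations $\pi$ of $I$ with $\pi(\xi)=\xi$ for all $\xi\in\{1\}\times\mathbb{N}$, and let $\Sigma_3=\Sigma(I,\mathfrak{G},{\cal I}_0^I)$. There is a second-order formula $H(x,D)$ in which the individual variable $x$ and the unary predicate variable $D$ occur free such that $\Sigma_3\models\neg choice^{1,1}(H)$, i.e. $choice^{1,1}(H)$ fails in $\Sigma_3$ (under a suitable assignment of the remaining free variables of $H$).
   Context: The metatheory is ZFC (assumed consistent). An $n$-ary predicate on $I$ is a map $\alpha:I^n\to\{true,false\}$. Permutations act on predicates by $(\pi\alpha)(\pi\xi_1,\dots,\pi\xi_n)=\alpha(\xi_1,\dots,\xi_n)$; ${\rm sym}_\mathfrak{G}(\alpha)=\{\pi\in\mathfrak{G}\mid\pi\alpha=\alpha\}$; $\mathfrak{G}(P)$ is the pointwise stabilizer in $\mathfrak{G}$ of $P\subseteq I$. ${\cal I}_0^I$ is the ideal of finite subsets of $I$. $\Sigma(I,\mathfrak{G},{\cal I}_0^I)=(J_n)_{n\ge0}$ is the second-order Henkin(–Asser) structure with individual domain $J_0=I$ in which $n$-ary predicate variables range over $J_n=$ the set of $n$-ary predicates $\alpha$ with ${\rm sym}_\mathfrak{G}(\alpha)\supseteq\mathfrak{G}(P)$ for some finite $P\subseteq I$. Formulas may contain further free variables, interpreted by assignments. Ackermann axiom ($D$ unary, $S$ binary): $choice^{1,1}(H)=\forall x\exists D H(x,D)\to\exists S\forall x H(x,\lambda y.Sxy)$,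 where $H(x,\lambda y.Sxy)$ is the result of substituting the predicate $\lambda y.Sxy$ for $D$. -}

module Defs where

open import Data.Nat using (ℕ; _≟_)
open import Data.Fin using (Fin; zero; suc)
open import Data.Bool using (Bool; true; false)
open import Data.Product using (Σ; _×_; _,_; ∃; proj₁)
open import Data.List using (List)
open import Data.List.Membership.Propositional using (_∈_)
open import Data.Vec using (Vec; map)
import Data.Vec
open import Data.Empty using (⊥)
open import Relation.Nullary using (¬_; yes; no)
open import Relation.Binary.PropositionalEquality using (_≡_; refl)
open import Function.Bundles using (_↔_; Inverse)

I : Set
I = Fin 2 × ℕ

Pred : ℕ → Set
Pred n = Vec I n → Bool

Perm : Set
Perm = I ↔ I

InG : Perm → Set
InG π = ∀ (m : ℕ) → Inverse.to π (suc zero , m) ≡ (suc zero , m)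

-- action:  (π α)(π ξ₁,…,π ξₙ) = α(ξ₁,…,ξₙ),  i.e. (π α)(ζ) = α(π⁻¹ ζ)
act : ∀ {n} → Perm → Pred n → Pred n
act π α ζ = α (map (Inverse.from π) ζ)

InSym : ∀ {n} → Perm → Pred n → Set
InSym π α = ∀ ζ → act π α ζ ≡ α ζ

InGP : List I → Perm → Set
InGP P π = InG π × (∀ ξ → ξ ∈ P → Inverse.to π ξ ≡ ξ)

-- J_n of Σ(I, 𝔊, 𝓘₀^I):  sym_𝔊(α) ⊇ 𝔊(P) for some finite P ⊆ I
InJ : (n : ℕ) → Pred n → Set
InJ n α = Σ (List I) λ P → ∀ π → InGP P π → InSym π α

data Formula : Set where
  atom : (n k : ℕ) → Vec ℕ n → Formula
  ¬'_  : Formula → Formula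
  _⇒_  : Formula → Formula → Formula
  ∀i   : ℕ → Formula → Formula
  ∀p   : (n k : ℕ) → Formula → Formula

record Assignment : Set where
  field
    ind  : ℕ → I
    pred : (n k : ℕ) → Pred n
open Assignment public

Valid : Assignment → Set
Valid a = ∀ n k → InJ n (pred a n k)

setInd : Assignment → ℕ → I → Assignment
ind  (setInd a k ξ) j with j ≟ k
... | yes _ = ξ
... | no  _ = ind a j
pred (setInd a k ξ) = pred a

setPred : Assignment → (n k : ℕ) → Pred n → Assignment
ind  (setPred a n k α) = ind a
pred (setPred a n k α) m j with m ≟ n | j ≟ k
... | yes refl | yes _ = α
... | _ | _ = pred a m j

-- Satisfaction in Σ₃ = Σ(I, 𝔊, 𝓘₀^I) (Henkin semantics: predicate
-- quantifiers range over J_n).  Classical truth via ¬, →, Π.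

_⊨_ : Assignment → Formula → Set
a ⊨ atom n k v = pred a n k (map (ind a) v) ≡ true
a ⊨ (¬' φ)     = ¬ (a ⊨ φ)
a ⊨ (φ ⇒ ψ)    = (a ⊨ φ) → (a ⊨ ψ)
a ⊨ ∀i k φ     = ∀ (ξ : I) → setInd a k ξ ⊨ φ
a ⊨ ∀p n k φ   = ∀ (α : Pred n) → InJ n α → setPred a n k α ⊨ φ

xVar : ℕ
xVar = 0

dVar : ℕ
dVar = 0

-- Σ₃ ⊨_a choice^{1,1}(H)  for
--   choice^{1,1}(H) = ∀x ∃D H(x,D) → ∃S ∀x H(x, λy.Sxy),
-- with ∃ read classically as ¬∀¬, and H(x, λy.Sxy) interpreted via the
-- (standard) semantics of substitution: D is assigned the predicate
-- y ↦ S(x,y) where x is the current value of the variable x.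
Choice11 : Formula → Assignment → Set
Choice11 H a =
  (∀ (ξ : I) → ¬ (∀ (δ : Pred 1) → InJ 1 δ →
                    ¬ (setPred (setInd a xVar ξ) 1 dVar δ ⊨ H)))
  → ¬ (∀ (σ : Pred 2) → InJ 2 σ →
         ¬ (∀ (ξ : I) →
              setPred (setInd a xVar ξ) 1 dVar
                      (λ ys → σ (ξ Data.Vec.∷ ys)) ⊨ H))

-- Let x range over the 𝔊-fixed points (1,n) and let H(x,D) say that D is a set of
-- atoms (0,m) in bijection with {(1,i) | i < n}.  For each x the initial segment of atoms is such
-- a D and is finitely supported.  A uniform choice S with support P would give, at x = (1,n) with
-- n > |P|, a set D = S(x,·) that is again supported by P, since 𝔊 fixes x.  Transpositions of
-- atoms outside P then show that D contains either all of them, so D is infinite, or none, so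
-- D ⊆ P has fewer than n elements; both contradict the bijection.
module Submission where

open import Defs
open import Data.Product using (Σ; _×_; ∃; _,_; proj₁; proj₂)
open import Relation.Nullary using (¬_; Dec; yes; no; does; contradiction)

open import Data.Bool using (Bool; true; false)
import Data.Bool.Properties as Bool
open import Data.Fin using (Fin; zero; suc; toℕ; fromℕ<)
open import Data.Fin.Properties using (any?; injective⇒≤; toℕ-injective; toℕ-fromℕ<; toℕ<n)
open import Data.List using (List; []; [_]; length; lookup; applyUpTo; _++_)
import Data.List as List
open import Data.List.Extrema.Nat using (max; xs≤max)
open import Data.List.Membership.Propositional using (_∈_; _∉_)
open import Data.List.Membership.Propositional.Properties using (∈-map⁺; ∈-applyUpTo⁺; ∈-++⁺ˡ; ∈-++⁺ʳ)
import Data.List.Relation.Unary.All as ListAll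
open import Data.List.Relation.Unary.Any using (here; index)
open import Data.List.Relation.Unary.Any.Properties using (lookup-index)
open import Data.Maybe using (Maybe; just; nothing; is-nothing)
open import Data.Nat using (ℕ; _<_; _≤_; _+_; _<?_)
import Data.Nat as ℕ
open import Data.Nat.Properties using (1+n≰n; <⇒≱; ≤-refl; ≤-trans; m≤m+n; +-cancelˡ-≡)
import Data.Product.Properties as Product
open import Data.Sum using (_⊎_; inj₁; inj₂)
open import Data.Vec using (Vec; []; _∷_; map)
open import Data.Vec.Properties using (map-∘; map-cong; map-id)
open import Data.Vec.Relation.Unary.All using (All; []; _∷_)
open import Function using (_∘_; _↔_; Inverse; mk↔ₛ′)
open import Relation.Binary.Definitions using (DecidableEquality)
open import Relation.Binary.PropositionalEquality using (_≡_; _≢_; refl; sym; trans; cong; cong₂; subst)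
open import Relation.Nullary.Decidable using (dec-true; _×-dec_)

dec-true⁻¹ : ∀ {A : Set} (a? : Dec A) → does a? ≡ true → A
dec-true⁻¹ (yes a) _ = a

≡-if-either-true : ∀ {a b : Bool} → (a ≡ true ⊎ b ≡ true → a ≡ b) → a ≡ b
≡-if-either-true {true}          agree = agree (inj₁ refl)
≡-if-either-true {false} {true}  agree = agree (inj₂ refl)
≡-if-either-true {false} {false} _     = refl

injective-relation⇒≤ : ∀ {m n} (R : Fin m → Fin n → Set) → (∀ i j → Dec (R i j)) →
                       (∀ i → ¬ (∀ j → ¬ R i j)) → (∀ {i i′ j} → R i j → R i′ j → i ≡ i′) → m ≤ n
injective-relation⇒≤ R R? total injective = injective⇒≤ f-injective
  where
  choose : ∀ i → ∃ (R i)
  choose i with any? (R? i)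
  ... | yes r = r
  ... | no ¬r = contradiction (λ j r → ¬r (j , r)) (total i)

  f-injective : ∀ {i i′} → proj₁ (choose i) ≡ proj₁ (choose i′) → i ≡ i′
  f-injective {i} {i′} e = injective (proj₂ (choose i)) (subst (R i′) (sym e) (proj₂ (choose i′)))

module Transposition {A : Set} (_≟_ : DecidableEquality A) (u v : A) where

  swap : A → A
  swap z with z ≟ u | z ≟ v
  ... | yes _ | _     = v
  ... | no _  | yes _ = u
  ... | no _  | no _  = z

  swap-u : swap u ≡ v
  swap-u with u ≟ u
  ... | yes _  = refl
  ... | no u≢u = contradiction refl u≢u

  swap-v : swap v ≡ u
  swap-v with v ≟ u | v ≟ v
  ... | yes v≡u | _      = v≡u
  ... | no _    | yes _  = refl
  ... | no _    | no v≢v = contradiction refl v≢v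

  swap-other : ∀ {z} → z ≢ u → z ≢ v → swap z ≡ z
  swap-other {z} z≢u z≢v with z ≟ u | z ≟ v
  ... | yes z≡u | _       = contradiction z≡u z≢u
  ... | no _    | yes z≡v = contradiction z≡v z≢v
  ... | no _    | no _    = refl

  swap-involutive : ∀ z → swap (swap z) ≡ z
  swap-involutive z = by-cases z (z ≟ u) (z ≟ v)
    where
    by-cases : ∀ z → Dec (z ≡ u) → Dec (z ≡ v) → swap (swap z) ≡ z
    by-cases _ (yes refl) _          = trans (cong swap swap-u) swap-v
    by-cases _ (no _)     (yes refl) = trans (cong swap swap-v) swap-u
    by-cases _ (no z≢u)   (no z≢v)   = trans (cong swap (swap-other z≢u z≢v)) (swap-other z≢u z≢v)

  transposition : A ↔ A
  transposition = mk↔ₛ′ swap swap swap-involutive swap-involutive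

pattern movable m = zero , m
pattern fixed n = suc zero , n

_≟I_ : DecidableEquality I
_≟I_ = Product.≡-dec Data.Fin._≟_ ℕ._≟_

open import Data.List.Membership.DecPropositional _≟I_ using (_∈?_)

Supports : ∀ {n} → List I → Pred n → Set
Supports P α = ∀ π → InGP P π → InSym π α

module _ (π : Perm) where
  open Inverse π

  from-fix : ∀ {z} → to z ≡ z → from z ≡ z
  from-fix {z} to-z≡z = trans (cong from (sym to-z≡z)) (strictlyInverseʳ z)

  map-to∘from : ∀ {n} (ζ : Vec I n) → map to (map from ζ) ≡ ζ
  map-to∘from ζ = trans (sym (map-∘ to from ζ)) (trans (map-cong strictlyInverseˡ ζ) (map-id ζ))

module _ {P : List I} (π : Perm) (π∈𝔊P : InGP P π) where
  open Inverse π

  to-fixes : ∀ {n} {ζ : Vec I n} → All (_∈ P) ζ → map to ζ ≡ ζ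
  to-fixes []          = refl
  to-fixes (z∈P ∷ ζ∈P) = cong₂ _∷_ (proj₂ π∈𝔊P _ z∈P) (to-fixes ζ∈P)

  from-fixes : ∀ {n} {ζ : Vec I n} → All (_∈ P) ζ → map from ζ ≡ ζ
  from-fixes []          = refl
  from-fixes (z∈P ∷ ζ∈P) = cong₂ _∷_ (from-fix π (proj₂ π∈𝔊P _ z∈P)) (from-fixes ζ∈P)

supports-true-set : ∀ {n} {P : List I} (α : Pred n) →
                    (∀ ζ → α ζ ≡ true → All (_∈ P) ζ) → Supports P α
supports-true-set α true⊆P π π∈𝔊P ζ = ≡-if-either-true (cong α ∘ fixed-by-π)
  where
  open Inverse π
  fixed-by-π : α (map from ζ) ≡ true ⊎ α ζ ≡ true → map from ζ ≡ ζ
  fixed-by-π (inj₁ e) = trans (sym (to-fixes π π∈𝔊P (true⊆P _ e))) (map-to∘from π ζ)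
  fixed-by-π (inj₂ e) = from-fixes π π∈𝔊P (true⊆P ζ e)

fixedIndex : I → Maybe ℕ
fixedIndex (movable _) = nothing
fixedIndex (fixed n)   = just n

fixedIndex-from : ∀ π → InG π → ∀ z → fixedIndex (Inverse.from π z) ≡ fixedIndex z
fixedIndex-from π π∈𝔊 (fixed m) = cong fixedIndex (from-fix π (π∈𝔊 m))
fixedIndex-from π π∈𝔊 (movable m) with Inverse.from π (movable m) in e
... | movable _ = refl
... | fixed m′  = contradiction fixed≡movable λ ()
  where
  fixed≡movable : fixed m′ ≡ movable m
  fixed≡movable = trans (sym (π∈𝔊 m′)) (trans (cong (Inverse.to π) (sym e)) (Inverse.strictlyInverseˡ π _))

supports-∘fixedIndex : ∀ {n} (β : Vec (Maybe ℕ) n → Bool) → Supports [] (β ∘ map fixedIndex)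
supports-∘fixedIndex β π (π∈𝔊 , _) ζ =
  cong β (trans (sym (map-∘ fixedIndex (Inverse.from π) ζ)) (map-cong (fixedIndex-from π π∈𝔊) ζ))

supports-section : ∀ {P : List I} {σ : Pred 2} m → Supports P σ → Supports P (λ ys → σ (fixed m ∷ ys))
supports-section {σ = σ} m σ-supp π π∈𝔊P ys =
  trans (cong (λ z → σ (z ∷ map (Inverse.from π) ys)) (sym (from-fix π (proj₁ π∈𝔊P m))))
        (σ-supp π π∈𝔊P (fixed m ∷ ys))

agrees-outside-support : ∀ {P : List I} {D : Pred 1} {a b} → Supports P D →
                         movable a ∉ P → movable b ∉ P → D (movable a ∷ []) ≡ D (movable b ∷ [])
agrees-outside-support {P} {D} {a} {b} D-supp a∉P b∉P =
  trans (cong (λ z → D (z ∷ [])) (sym swap-v)) (D-supp transposition τ∈𝔊P (movable b ∷ []))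
  where
  open Transposition _≟I_ (movable a) (movable b)
  τ∈𝔊P : InGP P transposition
  τ∈𝔊P = (λ _ → swap-other (λ ()) (λ ()))
       , (λ z z∈P → swap-other (λ { refl → a∉P z∈P }) (λ { refl → b∉P z∈P }))

fresh : List I → ℕ → I
fresh P j = movable (ℕ.suc (max 0 (List.map proj₂ P)) + j)

fresh∉ : ∀ P j → fresh P j ∉ P
fresh∉ P j fresh∈P =
  1+n≰n (≤-trans (m≤m+n _ j) (ListAll.lookup (xs≤max 0 _) (∈-map⁺ proj₂ fresh∈P)))

fresh-injective : ∀ P {j j′} → fresh P j ≡ fresh P j′ → j ≡ j′
fresh-injective P e = +-cancelˡ-≡ _ _ _ (cong proj₂ e)

-- The parameters of H: X¹₁(y) says y is an atom, X²₁(k, x) says k = (1,i) and x = (1,n) with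
-- i < n.  Both only see the 𝔊-invariant index of (1,·), hence have empty support.
parameter : (n k : ℕ) → Vec (Maybe ℕ) n → Bool
parameter 1 1 (m ∷ [])                = is-nothing m
parameter 2 1 (just i ∷ just n ∷ [])  = does (i <? n)
parameter _ _ _                       = false

a₀ : Assignment
ind a₀ _ = movable 0
pred a₀ n k = parameter n k ∘ map fixedIndex

a₀-valid : Valid a₀
a₀-valid n k = [] , supports-∘fixedIndex (parameter n k)

Movable : Pred 1
Movable = pred a₀ 1 1

Below : Pred 2
Below = pred a₀ 2 1

size : I → ℕ
size (movable _) = 0
size (fixed n)   = n

Below-inv : ∀ k ξ → Below (k ∷ ξ ∷ []) ≡ true → ∃ λ i → k ≡ fixed i × i < size ξ
Below-inv (fixed i)   (fixed n)   k<ξ = i , refl , dec-true⁻¹ (i <? n) k<ξ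
Below-inv (movable _) _           ()
Below-inv (fixed _)   (movable _) ()

Below-intro : ∀ {i} ξ → i < size ξ → Below (fixed i ∷ ξ ∷ []) ≡ true
Below-intro {i} (fixed n)   i<n = dec-true (i <? n) i<n
Below-intro     (movable _) ()

-- Variables: x = 0, y = 1, k = 2, and 3 for a second y or k; D = X¹₀, F = X²₀, and X¹₂ is
-- quantified in the Leibniz equality.  ∃ and ∧ are encoded so that the meaning of H unfolds
-- to the curried types in the record Enumerates below.
∃i[_]_∧_ : ℕ → Formula → Formula → Formula
∃i[ v ] φ ∧ ψ = ¬' ∀i v (φ ⇒ (¬' ψ))

infix 25 _≐_
_≐_ : ℕ → ℕ → Formula
u ≐ v = ∀p 1 2 (atom 1 2 (u ∷ []) ⇒ atom 1 2 (v ∷ []))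

Dᶠ Movableᶠ : ℕ → Formula
Dᶠ y = atom 1 dVar (y ∷ [])
Movableᶠ y = atom 1 1 (y ∷ [])

Fᶠ Belowᶠ : ℕ → ℕ → Formula
Fᶠ k y = atom 2 0 (k ∷ y ∷ [])
Belowᶠ k x = atom 2 1 (k ∷ x ∷ [])

H : Formula
H = ¬' ∀p 2 0 (D⊆Movable ⇒ (total ⇒ (onto ⇒ (injective ⇒ (¬' functional)))))
  where
  D⊆Movable total onto injective functional : Formula
  D⊆Movable = ∀i 1 (Dᶠ 1 ⇒ Movableᶠ 1)
  total      = ∀i 2 (Belowᶠ 2 xVar ⇒ (∃i[ 1 ] Dᶠ 1 ∧ Fᶠ 2 1))
  onto       = ∀i 1 (Dᶠ 1 ⇒ (∃i[ 2 ] Belowᶠ 2 xVar ∧ Fᶠ 2 1))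
  injective  = ∀i 2 (∀i 3 (∀i 1 (Fᶠ 2 1 ⇒ (Fᶠ 3 1 ⇒ 2 ≐ 3))))
  functional = ∀i 2 (∀i 1 (∀i 3 (Fᶠ 2 1 ⇒ (Fᶠ 2 3 ⇒ 1 ≐ 3))))

Indiscernible : I → I → Set
Indiscernible u v = ∀ X → InJ 1 X → X (u ∷ []) ≡ true → X (v ∷ []) ≡ true

indiscernible⇒≡ : ∀ {u v} → Indiscernible u v → u ≡ v
indiscernible⇒≡ {u} {v} u≐v = dec-true⁻¹ (u ≟I v) (u≐v singleton singleton∈J (dec-true (u ≟I u) refl))
  where
  singleton : Pred 1
  singleton (z ∷ []) = does (u ≟I z)
  singleton⊆[u] : ∀ ζ → singleton ζ ≡ true → All (_∈ [ u ]) ζ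
  singleton⊆[u] (z ∷ []) e = here (sym (dec-true⁻¹ (u ≟I z) e)) ∷ []
  singleton∈J : InJ 1 singleton
  singleton∈J = [ u ] , supports-true-set singleton singleton⊆[u]

≡⇒indiscernible : ∀ {u v} → u ≡ v → Indiscernible u v
≡⇒indiscernible refl _ _ Xu = Xu

record Enumerates (ξ : I) (D : Pred 1) (F : Pred 2) : Set where
  field
    ⊆movable   : ∀ y → D (y ∷ []) ≡ true → Movable (y ∷ []) ≡ true
    total      : ∀ k → Below (k ∷ ξ ∷ []) ≡ true → ¬ (∀ y → D (y ∷ []) ≡ true → ¬ F (k ∷ y ∷ []) ≡ true)
    onto       : ∀ y → D (y ∷ []) ≡ true → ¬ (∀ k → Below (k ∷ ξ ∷ []) ≡ true → ¬ F (k ∷ y ∷ []) ≡ true)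
    injective  : ∀ k k′ y → F (k ∷ y ∷ []) ≡ true → F (k′ ∷ y ∷ []) ≡ true → Indiscernible k k′
    functional : ∀ k y y′ → F (k ∷ y ∷ []) ≡ true → F (k ∷ y′ ∷ []) ≡ true → Indiscernible y y′

module _ {ξ : I} {D : Pred 1} where

  Env : Assignment
  Env = setPred (setInd a₀ xVar ξ) 1 dVar D

  enumerates⇒⊨H : ∀ {F} → InJ 2 F → Enumerates ξ D F → Env ⊨ H
  enumerates⇒⊨H {F} F∈J e none =
    none F F∈J (Enumerates.⊆movable e) (Enumerates.total e) (Enumerates.onto e)
         (Enumerates.injective e) (Enumerates.functional e)

  ⊨H⇒enumerates : Env ⊨ H → ¬ (∀ F → InJ 2 F → ¬ Enumerates ξ D F)
  ⊨H⇒enumerates ⊨H none = ⊨H λ F F∈J ⊆movable total onto injective functional →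
    none F F∈J (record { ⊆movable = ⊆movable ; total = total ; onto = onto
                       ; injective = injective ; functional = functional })

initialSegment : ℕ → Pred 1
initialSegment n (movable j ∷ []) = does (j <? n)
initialSegment n (fixed _ ∷ [])   = false

initialSegment-inv : ∀ {n} y → initialSegment n (y ∷ []) ≡ true → ∃ λ j → y ≡ movable j × j < n
initialSegment-inv {n} (movable j) e = j , refl , dec-true⁻¹ (j <? n) e
initialSegment-inv (fixed _) ()

pairing : ℕ → Pred 2
pairing n (fixed i ∷ movable j ∷ []) = does (i ℕ.≟ j ×-dec j <? n)
pairing n _                          = false

pairing-intro : ∀ {n j} → j < n → pairing n (fixed j ∷ movable j ∷ []) ≡ true
pairing-intro {n} {j} j<n = dec-true (j ℕ.≟ j ×-dec j <? n) (refl , j<n)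

pairing-inv : ∀ {n} k y → pairing n (k ∷ y ∷ []) ≡ true → ∃ λ j → k ≡ fixed j × y ≡ movable j × j < n
pairing-inv {n} (fixed i) (movable j) e with dec-true⁻¹ (i ℕ.≟ j ×-dec j <? n) e
... | refl , j<n = j , refl , refl , j<n
pairing-inv (movable _) _           ()
pairing-inv (fixed _)   (fixed _)   ()

initialSegment-supported : ∀ n → InJ 1 (initialSegment n)
initialSegment-supported n = applyUpTo movable n , supports-true-set (initialSegment n) true⊆
  where
  true⊆ : ∀ ζ → initialSegment n ζ ≡ true → All (_∈ applyUpTo movable n) ζ
  true⊆ (y ∷ []) e with initialSegment-inv y e
  ... | j , refl , j<n = ∈-applyUpTo⁺ movable j<n ∷ []

pairing-supported : ∀ n → InJ 2 (pairing n)
pairing-supported n = P , supports-true-set (pairing n) true⊆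
  where
  P : List I
  P = applyUpTo fixed n ++ applyUpTo movable n
  true⊆ : ∀ ζ → pairing n ζ ≡ true → All (_∈ P) ζ
  true⊆ (k ∷ y ∷ []) e with pairing-inv k y e
  ... | j , refl , refl , j<n =
    ∈-++⁺ˡ (∈-applyUpTo⁺ fixed j<n) ∷ ∈-++⁺ʳ (applyUpTo fixed n) (∈-applyUpTo⁺ movable j<n) ∷ []

pairing-enumerates : ∀ ξ → Enumerates ξ (initialSegment (size ξ)) (pairing (size ξ))
pairing-enumerates ξ = record
  { ⊆movable   = ⊆movable
  ; total      = total
  ; onto       = onto
  ; injective  = injective
  ; functional = functional
  }
  where
  ⊆movable : ∀ y → initialSegment (size ξ) (y ∷ []) ≡ true → Movable (y ∷ []) ≡ true
  ⊆movable y e with initialSegment-inv y e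
  ... | _ , refl , _ = refl

  total : ∀ k → Below (k ∷ ξ ∷ []) ≡ true →
          ¬ (∀ y → initialSegment (size ξ) (y ∷ []) ≡ true → ¬ pairing (size ξ) (k ∷ y ∷ []) ≡ true)
  total k k<ξ none with Below-inv k ξ k<ξ
  ... | i , refl , i<n = none (movable i) (dec-true (i <? size ξ) i<n) (pairing-intro i<n)

  onto : ∀ y → initialSegment (size ξ) (y ∷ []) ≡ true →
         ¬ (∀ k → Below (k ∷ ξ ∷ []) ≡ true → ¬ pairing (size ξ) (k ∷ y ∷ []) ≡ true)
  onto y e none with initialSegment-inv y e
  ... | j , refl , j<n = none (fixed j) (Below-intro ξ j<n) (pairing-intro j<n)

  injective : ∀ k k′ y → pairing (size ξ) (k ∷ y ∷ []) ≡ true → pairing (size ξ) (k′ ∷ y ∷ []) ≡ true →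
              Indiscernible k k′
  injective k k′ y e e′ with pairing-inv k y e | pairing-inv k′ y e′
  ... | j , refl , refl , _ | .j , refl , refl , _ = ≡⇒indiscernible refl

  functional : ∀ k y y′ → pairing (size ξ) (k ∷ y ∷ []) ≡ true → pairing (size ξ) (k ∷ y′ ∷ []) ≡ true →
               Indiscernible y y′
  functional k y y′ e e′ with pairing-inv k y e | pairing-inv k y′ e′
  ... | j , refl , refl , _ | .j , refl , refl , _ = ≡⇒indiscernible refl

module _ {P : List I} {D : Pred 1} {F : Pred 2} {n : ℕ}
         (D-supp : Supports P D) (enum : Enumerates (fixed n) D F) where
  open Enumerates enum

  fresh∈D⇒1+n≤n : D (fresh P 0 ∷ []) ≡ true → ℕ.suc n ≤ n
  fresh∈D⇒1+n≤n fresh∈D = injective-relation⇒≤ R (λ j i → _ Bool.≟ true) R-total R-injective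
    where
    y : Fin (ℕ.suc n) → I
    y j = fresh P (toℕ j)

    R : Fin (ℕ.suc n) → Fin n → Set
    R j i = F (fixed (toℕ i) ∷ y j ∷ []) ≡ true

    y∈D : ∀ j → D (y j ∷ []) ≡ true
    y∈D j = trans (agrees-outside-support D-supp (fresh∉ P (toℕ j)) (fresh∉ P 0)) fresh∈D

    R-total : ∀ j → ¬ (∀ i → ¬ R j i)
    R-total j none = onto (y j) (y∈D j) no-preimage
      where
      no-preimage : ∀ k → Below (k ∷ fixed n ∷ []) ≡ true → ¬ F (k ∷ y j ∷ []) ≡ true
      no-preimage k k<n with Below-inv k (fixed n) k<n
      ... | i , refl , i<n =
        none (fromℕ< i<n) ∘ subst (λ t → F (fixed t ∷ y j ∷ []) ≡ true) (sym (toℕ-fromℕ< i<n))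

    R-injective : ∀ {j j′ i} → R j i → R j′ i → j ≡ j′
    R-injective Rji Rj′i =
      toℕ-injective (fresh-injective P (indiscernible⇒≡ (functional _ _ _ Rji Rj′i)))

  fresh∉D⇒n≤|P| : D (fresh P 0 ∷ []) ≡ false → n ≤ length P
  fresh∉D⇒n≤|P| fresh∉D = injective-relation⇒≤ R (λ i p → _ Bool.≟ true) R-total R-injective
    where
    R : Fin n → Fin (length P) → Set
    R i p = F (fixed (toℕ i) ∷ lookup P p ∷ []) ≡ true

    D⊆P : ∀ y → D (y ∷ []) ≡ true → y ∈ P
    D⊆P (fixed _) y∈D with () ← ⊆movable _ y∈D
    D⊆P (movable m) y∈D with movable m ∈? P
    ... | yes y∈P = y∈P
    ... | no y∉P  = contradiction (trans (sym y∈D) y∉D) λ ()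
      where
      y∉D : D (movable m ∷ []) ≡ false
      y∉D = trans (agrees-outside-support D-supp y∉P (fresh∉ P 0)) fresh∉D

    R-total : ∀ i → ¬ (∀ p → ¬ R i p)
    R-total i none = total (fixed (toℕ i)) (Below-intro (fixed n) (toℕ<n i)) λ y y∈D →
      none (index (D⊆P y y∈D))
      ∘ subst (λ z → F (fixed (toℕ i) ∷ z ∷ []) ≡ true) (lookup-index (D⊆P y y∈D))

    R-injective : ∀ {i i′ p} → R i p → R i′ p → i ≡ i′
    R-injective Rip Ri′p = toℕ-injective (cong proj₂ (indiscernible⇒≡ (injective _ _ _ Rip Ri′p)))

no-enumeration : ∀ {P : List I} {D : Pred 1} {F : Pred 2} {n} →
                 Supports P D → length P < n → ¬ Enumerates (fixed n) D F
no-enumeration {P} {D} D-supp |P|<n enum with D (fresh P 0 ∷ []) in e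
... | true  = 1+n≰n (fresh∈D⇒1+n≤n D-supp enum e)
... | false = <⇒≱ |P|<n (fresh∉D⇒n≤|P| D-supp enum e)

corollary2p16 : Σ Formula λ H → Σ Assignment λ a → Valid a × ¬ Choice11 H a
corollary2p16 = H , a₀ , a₀-valid , λ choice → choice enumeration-exists no-uniform-enumeration
  where
  enumeration-exists : ∀ ξ → ¬ (∀ δ → InJ 1 δ → ¬ (setPred (setInd a₀ xVar ξ) 1 dVar δ ⊨ H))
  enumeration-exists ξ none =
    none (initialSegment (size ξ)) (initialSegment-supported (size ξ))
         (enumerates⇒⊨H (pairing-supported (size ξ)) (pairing-enumerates ξ))

  no-uniform-enumeration : ∀ σ → InJ 2 σ →
                           ¬ (∀ ξ → setPred (setInd a₀ xVar ξ) 1 dVar (λ ys → σ (ξ ∷ ys)) ⊨ H)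
  no-uniform-enumeration σ (P , σ-supp) ⊨H-everywhere =
    ⊨H⇒enumerates (⊨H-everywhere ξ) λ _ _ → no-enumeration (supports-section n σ-supp) ≤-refl
    where
    n : ℕ
    n = ℕ.suc (length P)
    ξ : I
    ξ = fixed n
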